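{- Let $\Gamma=(V,E)$ be a finite simple connected graph satisfying conditions (C1) and (C2). Then $D(\Box\Gamma)=D(\Gamma)+1$, and the graph $\Box\Gamma$ also satisfies (C1) and (C2).
   Context: For a finite simple connected graph $\Delta$, $d_\Delta$ is its shortest-path distance and $D(\Delta)$ its diameter. The diametral doubling $\Box\Delta$ has vertex set $V^+\cup V^-$ (two disjoint copies $\{x^+\}$, $\{x^-\}$ of the vertex set $V$ of $\Delta$); $x^\mu$ is adjacent to $y^\epsilon$ if either $\mu=\epsilon$ and $x,y$ are adjacent in $\Delta$, or $\mu\ne\epsilon$ and $d_\Delta(x,y)=D(\Delta)$. Condition (C1) for $\Delta$: $d_\Delta(x,y)\le 2+d_\Delta(z_1,z_2)$ for all vertices $x,y,z_1,z_2$ with $d_\Delta(x,z_1)=d_\Delta(y,z_2)=D(\Delta)$. Condition (C2) for $\Delta$: $d_{\Box\Delta}(x^+,y^-)=D(\Delta)+1-d_\Delta(x,y)$ for all vertices $x,y$ of $\Delta$. -}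

module Defs where

open import Data.Nat using (ℕ; zero; suc; _+_; _∸_; _≤_)
open import Data.Bool using (Bool; true; false)
open import Data.Product using (_×_; Σ; ∃; ∃-syntax; _,_)
open import Data.Sum using (_⊎_)
open import Relation.Binary.PropositionalEquality using (_≡_; _≢_)
open import Relation.Nullary using (¬_)

data Walk {V : Set} (Adj : V → V → Set) : V → V → ℕ → Set where
  nil  : ∀ {x} → Walk Adj x x 0
  cons : ∀ {x y z k} → Adj x y → Walk Adj y z k → Walk Adj x z (suc k)

Dist : {V : Set} → (V → V → Set) → V → V → ℕ → Set
Dist Adj x y d = Walk Adj x y d × (∀ k → Walk Adj x y k → d ≤ k)

-- Finite simple connected graph on vertex set Fin n (V = Fin n supplied by caller).
Symmetric : {V : Set} → (V → V → Set) → Set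
Symmetric {V} Adj = ∀ (x y : V) → Adj x y → Adj y x

Irreflexive : {V : Set} → (V → V → Set) → Set
Irreflexive {V} Adj = ∀ (x : V) → ¬ Adj x x

Connected : {V : Set} → (V → V → Set) → Set
Connected {V} Adj = ∀ (x y : V) → ∃[ k ] Walk Adj x y k

IsDiam : {V : Set} → (V → V → Set) → ℕ → Set
IsDiam {V} Adj D =
  (∀ (x y : V) → ∃[ d ] (Dist Adj x y d × d ≤ D))
  × (Σ V λ x → Σ V λ y → Dist Adj x y D)

-- Diametral doubling with respect to D (to be instantiated with D = D(Δ)).
-- Vertex (true , x) is x⁺, (false , x) is x⁻.
BoxAdj : {V : Set} → (V → V → Set) → ℕ → Bool × V → Bool × V → Set
BoxAdj Adj D (μ , x) (ε , y) = (μ ≡ ε × Adj x y) ⊎ (μ ≢ ε × Dist Adj x y D)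

C1 : {V : Set} → (V → V → Set) → ℕ → Set
C1 {V} Adj D = ∀ (x y z₁ z₂ : V) (a b : ℕ) →
  Dist Adj x z₁ D → Dist Adj y z₂ D →
  Dist Adj x y a → Dist Adj z₁ z₂ b → a ≤ 2 + b

C2 : {V : Set} → (V → V → Set) → ℕ → Set
C2 {V} Adj D = ∀ (x y : V) (a : ℕ) → Dist Adj x y a →
  Dist (BoxAdj Adj D) (true , x) (false , y) (suc D ∸ a)

{-# OPTIONS --safe #-}
module Submission where

-- Within one layer of □Γ distances are those of Γ: a walk that leaves the layer must return
-- through a second diametral edge, and (C1) shows that this detour is never shorter. With (C2)
-- this determines all distances, d(x^μ, y^μ) = d(x, y) and d(x⁺, y⁻) = D + 1 − d(x, y), so
-- D(□Γ) = D + 1 and the only vertex at distance D + 1 from X = x^μ is its antipode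
-- X̄ = x^(not μ). Swapping the layers is an automorphism, which gives (C1) for □Γ since
-- d(X, Y) = d(X̄, Ȳ). For (C2), going from X⁺ to X̄⁻ and then along a shortest path to Y⁻ takes
-- 1 + d(X̄, Y) = D + 2 − d(X, Y) steps; conversely a walk from X⁺ to Y⁻ crosses some diametral
-- edge X'⁺ ~ X̄'⁻, and D + 1 = d(X', X̄') ≤ d(X', X) + d(X, Y) + d(Y, X̄') bounds its length,
-- the last term by the layer argument applied to □Γ, which satisfies (C1).

open import Defs
open import Data.Nat using (ℕ; suc; _+_; _∸_; _≤_; s≤s)
open import Data.Nat.Properties
open import Data.Fin using (Fin)
open import Data.Bool using (Bool; true; false; not)
open import Data.Bool.Properties using (not-injective; ¬-not)
open import Data.Product using (_×_; _,_; proj₁; proj₂)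
open import Data.Sum using (inj₁; inj₂)
open import Data.Empty using (⊥-elim)
open import Function using (_∘′_)
open import Relation.Binary.PropositionalEquality

private
  variable
    V : Set
    R : V → V → Set
    D k m n : ℕ
    x y z : V
    X Y : Bool × V

_++_ : Walk R x y m → Walk R y z n → Walk R x z (m + n)
nil ++ w = w
cons r v ++ w = cons r (v ++ w)

snoc : Walk R x y k → R y z → Walk R x z (suc k)
snoc nil r = cons r nil
snoc (cons r' w) r = cons r' (snoc w r)

reverse : Symmetric R → Walk R x y k → Walk R y x k
reverse R-sym nil = nil
reverse R-sym (cons r w) = snoc (reverse R-sym w) (R-sym _ _ r)

Walk-0 : Walk R x y 0 → x ≡ y
Walk-0 nil = refl

Dist-unique : Dist R x y m → Dist R x y n → m ≡ n
Dist-unique (wm , min-m) (wn , min-n) = ≤-antisym (min-m _ wn) (min-n _ wm)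

Dist-sym : Symmetric R → Dist R x y k → Dist R y x k
Dist-sym R-sym (w , minimal) = reverse R-sym w , λ k w' → minimal k (reverse R-sym w')

≢-≢⇒≡ : ∀ {μ ν ε : Bool} → μ ≢ ν → μ ≢ ε → ν ≡ ε
≢-≢⇒≡ μ≢ν μ≢ε = trans (¬-not (≢-sym μ≢ν)) (sym (¬-not (≢-sym μ≢ε)))

BoxAdj-sym : Symmetric R → Symmetric (BoxAdj R D)
BoxAdj-sym R-sym _ _ (inj₁ (μ≡ε , r)) = inj₁ (sym μ≡ε , R-sym _ _ r)
BoxAdj-sym R-sym _ _ (inj₂ (μ≢ε , d)) = inj₂ (≢-sym μ≢ε , Dist-sym R-sym d)

inLayer : ∀ {μ} → Walk R x y k → Walk (BoxAdj R D) (μ , x) (μ , y) k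
inLayer nil = nil
inLayer (cons r w) = cons (inj₁ (refl , r)) (inLayer w)

antipode : Bool × V → Bool × V
antipode (μ , x) = (not μ , x)

antipode-walk : Walk (BoxAdj R D) X Y k → Walk (BoxAdj R D) (antipode X) (antipode Y) k
antipode-walk nil = nil
antipode-walk (cons (inj₁ (μ≡ν , r)) w) = cons (inj₁ (cong not μ≡ν , r)) (antipode-walk w)
antipode-walk (cons (inj₂ (μ≢ν , d)) w) =
  cons (inj₂ (μ≢ν ∘′ not-injective , d)) (antipode-walk w)

module Metric {V : Set} {R : V → V → Set} (R-sym : Symmetric R)
              (δ : V → V → ℕ) (δ-dist : ∀ x y → Dist R x y (δ x y)) where

  δ-minimal : ∀ {x y k} → Walk R x y k → δ x y ≤ k
  δ-minimal w = proj₂ (δ-dist _ _) _ w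

  δ-unique : ∀ {x y d} → Dist R x y d → d ≡ δ x y
  δ-unique d = Dist-unique d (δ-dist _ _)

  δ-triangle : ∀ x y z → δ x z ≤ δ x y + δ y z
  δ-triangle x y z = δ-minimal (proj₁ (δ-dist x y) ++ proj₁ (δ-dist y z))

  δ-sym : ∀ x y → δ x y ≡ δ y x
  δ-sym x y = Dist-unique (δ-dist x y) (Dist-sym R-sym (δ-dist y x))

  δ-refl : ∀ x → δ x x ≡ 0
  δ-refl x = n≤0⇒n≡0 (δ-minimal nil)

  δ-adjacent : ∀ {x y} → R x y → δ x y ≤ 1
  δ-adjacent r = δ-minimal (cons r nil)

  δ≡0⇒≡ : ∀ {x y} → δ x y ≡ 0 → x ≡ y
  δ≡0⇒≡ {x} {y} δ≡0 = Walk-0 (subst (Walk R x y) δ≡0 (proj₁ (δ-dist x y)))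

module LayerBounds {V : Set} {R : V → V → Set} (R-sym : Symmetric R)
                   (δ : V → V → ℕ) (δ-dist : ∀ x y → Dist R x y (δ x y))
                   (D : ℕ) (c1 : C1 R D) where

  open Metric R-sym δ δ-dist
  open ≤-Reasoning

  private
    B = BoxAdj R D

  -- same-layer alone is not inductive: cross-layer is the invariant while the walk is in the
  -- other layer, and (C1) converts between the two at each diametral edge.
  mutual
    same-layer : ∀ {μ ε a y k} → μ ≡ ε → Walk B (μ , a) (ε , y) k → δ a y ≤ k
    same-layer refl nil = ≤-reflexive (δ-refl _)
    same-layer {a = a} {y} {suc k} refl (cons {y = _ , b} (inj₁ (refl , a~b)) w) = begin
      δ a y          ≤⟨ δ-triangle a b y ⟩
      δ a b + δ b y  ≤⟨ +-mono-≤ (δ-adjacent a~b) (same-layer refl w) ⟩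
      suc k          ∎
    same-layer {a = a} {y} {suc k} refl (cons {y = _ , b} (inj₂ (μ≢ν , a-b)) w) = begin
      δ a y              ≤⟨ cross-layer (≢-sym μ≢ν) w a-b ⟩
      suc (δ b b + k)    ≡⟨ cong (λ t → suc (t + k)) (δ-refl b) ⟩
      suc k              ∎

    cross-layer : ∀ {μ ε a y k u u'} → μ ≢ ε → Walk B (μ , a) (ε , y) k →
                  Dist R u u' D → δ u y ≤ suc (δ u' a + k)
    cross-layer μ≢ε nil _ = ⊥-elim (μ≢ε refl)
    cross-layer {a = a} {y} {suc k} {u} {u'} μ≢ε (cons {y = _ , b} (inj₁ (refl , a~b)) w) u-u' =
      begin
      δ u y                    ≤⟨ cross-layer μ≢ε w u-u' ⟩
      suc (δ u' b + k)         ≤⟨ s≤s (+-monoˡ-≤ k (δ-triangle u' a b)) ⟩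
      suc (δ u' a + δ a b + k) ≤⟨ s≤s (+-monoˡ-≤ k (+-monoʳ-≤ (δ u' a) (δ-adjacent a~b))) ⟩
      suc (δ u' a + 1 + k)     ≡⟨ cong suc (+-assoc (δ u' a) 1 k) ⟩
      suc (δ u' a + suc k)     ∎
    cross-layer {a = a} {y} {suc k} {u} {u'} μ≢ε (cons {y = _ , b} (inj₂ (μ≢ν , a-b)) w) u-u' =
      begin
      δ u y                    ≤⟨ δ-triangle u b y ⟩
      δ u b + δ b y            ≤⟨ +-mono-≤ u-b-bound (same-layer (≢-≢⇒≡ μ≢ν μ≢ε) w) ⟩
      2 + δ u' a + k           ≡⟨ cong suc (+-suc (δ u' a) k) ⟨
      suc (δ u' a + suc k)     ∎
      where
      u-b-bound : δ u b ≤ 2 + δ u' a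
      u-b-bound = c1 u b u' a _ _ u-u' (Dist-sym R-sym a-b) (δ-dist u b) (δ-dist u' a)

  crossing-length : ∀ {μ ε a y k} → μ ≢ ε → Walk B (μ , a) (ε , y) k → suc D ≤ δ a y + k
  crossing-length μ≢ε nil = ⊥-elim (μ≢ε refl)
  crossing-length {a = a} {y} {suc k} μ≢ε (cons {y = _ , b} (inj₁ (refl , a~b)) w) = begin
    suc D            ≤⟨ crossing-length μ≢ε w ⟩
    δ b y + k        ≤⟨ +-monoˡ-≤ k (δ-triangle b a y) ⟩
    δ b a + δ a y + k ≤⟨ +-monoˡ-≤ k (+-monoˡ-≤ (δ a y) (δ-adjacent (R-sym _ _ a~b))) ⟩
    suc (δ a y + k)  ≡⟨ +-suc (δ a y) k ⟨
    δ a y + suc k    ∎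
  crossing-length {a = a} {y} {suc k} μ≢ε (cons {y = _ , b} (inj₂ (μ≢ν , a-b)) w) = begin
    suc D             ≡⟨ cong suc (δ-unique a-b) ⟩
    suc (δ a b)       ≤⟨ s≤s (δ-triangle a y b) ⟩
    suc (δ a y + δ y b) ≡⟨ cong (λ t → suc (δ a y + t)) (δ-sym y b) ⟩
    suc (δ a y + δ b y) ≤⟨ s≤s (+-monoʳ-≤ (δ a y) (same-layer (≢-≢⇒≡ μ≢ν μ≢ε) w)) ⟩
    suc (δ a y + k)   ≡⟨ +-suc (δ a y) k ⟨
    δ a y + suc k     ∎

module Doubling {V : Set} {R : V → V → Set} (R-sym : Symmetric R) (D : ℕ)
                (diam : IsDiam R D) (c1 : C1 R D) (c2 : C2 R D) where

  δ : V → V → ℕ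
  δ x y = proj₁ (proj₁ diam x y)

  δ-dist : ∀ x y → Dist R x y (δ x y)
  δ-dist x y = proj₁ (proj₂ (proj₁ diam x y))

  δ≤D : ∀ x y → δ x y ≤ D
  δ≤D x y = proj₂ (proj₂ (proj₁ diam x y))

  private
    B = BoxAdj R D
    B-sym = BoxAdj-sym {D = D} R-sym
    module Base = Metric R-sym δ δ-dist
    module BaseLayers = LayerBounds R-sym δ δ-dist D c1

  δ□ : Bool × V → Bool × V → ℕ
  δ□ (true  , x) (true  , y) = δ x y
  δ□ (false , x) (false , y) = δ x y
  δ□ (true  , x) (false , y) = suc D ∸ δ x y
  δ□ (false , x) (true  , y) = suc D ∸ δ y x

  layer-dist : ∀ μ x y → Dist B (μ , x) (μ , y) (δ x y)
  layer-dist μ x y = inLayer (proj₁ (δ-dist x y)) , λ k w → BaseLayers.same-layer refl w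

  δ□-dist : ∀ X Y → Dist B X Y (δ□ X Y)
  δ□-dist (true  , x) (true  , y) = layer-dist true x y
  δ□-dist (false , x) (false , y) = layer-dist false x y
  δ□-dist (true  , x) (false , y) = c2 x y (δ x y) (δ-dist x y)
  δ□-dist (false , x) (true  , y) = Dist-sym B-sym (c2 y x (δ y x) (δ-dist y x))

  δ□≤1+D : ∀ X Y → δ□ X Y ≤ suc D
  δ□≤1+D (true  , x) (true  , y) = m≤n⇒m≤1+n (δ≤D x y)
  δ□≤1+D (false , x) (false , y) = m≤n⇒m≤1+n (δ≤D x y)
  δ□≤1+D (true  , x) (false , y) = m∸n≤m (suc D) (δ x y)
  δ□≤1+D (false , x) (true  , y) = m∸n≤m (suc D) (δ y x)

  δ□-antipode : ∀ X Y → δ□ (antipode X) Y ≡ suc D ∸ δ□ X Y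
  δ□-antipode (true  , x) (true  , y) = cong (suc D ∸_) (Base.δ-sym y x)
  δ□-antipode (true  , x) (false , y) = sym (m∸[m∸n]≡n (m≤n⇒m≤1+n (δ≤D x y)))
  δ□-antipode (false , x) (true  , y) =
    trans (Base.δ-sym x y) (sym (m∸[m∸n]≡n (m≤n⇒m≤1+n (δ≤D y x))))
  δ□-antipode (false , x) (false , y) = refl

  private
    module Box = Metric B-sym δ□ δ□-dist

  δ□-to-antipode : ∀ X → δ□ X (antipode X) ≡ suc D
  δ□-to-antipode (true  , x) = cong (suc D ∸_) (Base.δ-refl x)
  δ□-to-antipode (false , x) = cong (suc D ∸_) (Base.δ-refl x)

  antipode-dist : ∀ X → Dist B X (antipode X) (suc D)
  antipode-dist X = subst (Dist B X (antipode X)) (δ□-to-antipode X) (δ□-dist X (antipode X))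

  diametral⇒antipode : ∀ {X Y} → Dist B X Y (suc D) → antipode X ≡ Y
  diametral⇒antipode {X} {Y} X-Y = Box.δ≡0⇒≡ (begin
    δ□ (antipode X) Y  ≡⟨ δ□-antipode X Y ⟩
    suc D ∸ δ□ X Y     ≡⟨ cong (suc D ∸_) (Box.δ-unique X-Y) ⟨
    suc D ∸ suc D      ≡⟨ n∸n≡0 (suc D) ⟩
    0                  ∎)
    where open ≡-Reasoning

  □-IsDiam : IsDiam B (suc D)
  □-IsDiam = (λ X Y → δ□ X Y , δ□-dist X Y , δ□≤1+D X Y)
           , (true , v) , (false , v) , antipode-dist (true , v)
    where v = proj₁ (proj₂ diam)

  □-C1 : C1 B (suc D)
  □-C1 X Y Z₁ Z₂ a b X-Z₁ Y-Z₂ X-Y Z₁-Z₂ = ≤-trans (proj₂ X-Y b X⇝Y) (m≤n+m b 2)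
    where
    X⇝Y : Walk B X Y b
    X⇝Y = subst₂ (λ P Q → Walk B P Q b)
      (diametral⇒antipode (Dist-sym B-sym X-Z₁)) (diametral⇒antipode (Dist-sym B-sym Y-Z₂))
      (antipode-walk (proj₁ Z₁-Z₂))

  private
    BB = BoxAdj B (suc D)
    module BoxLayers = LayerBounds B-sym δ□ δ□-dist (suc D) □-C1

  □□-cross-dist : ∀ X Y → Dist BB (true , X) (false , Y) (suc (suc D) ∸ δ□ X Y)
  □□-cross-dist X Y = subst (Walk BB _ _) length-eq via-antipode , minimal
    where
    via-antipode : Walk BB (true , X) (false , Y) (suc (δ□ (antipode X) Y))
    via-antipode = cons (inj₂ ((λ ()) , antipode-dist X)) (inLayer (proj₁ (δ□-dist (antipode X) Y)))
    length-eq : suc (δ□ (antipode X) Y) ≡ suc (suc D) ∸ δ□ X Y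
    length-eq = trans (cong suc (δ□-antipode X Y)) (sym (+-∸-assoc 1 (δ□≤1+D X Y)))
    minimal : ∀ k → Walk BB (true , X) (false , Y) k → suc (suc D) ∸ δ□ X Y ≤ k
    minimal k w = m≤n+o⇒m∸n≤o (suc (suc D)) (δ□ X Y) (BoxLayers.crossing-length (λ ()) w)

  □-C2 : C2 B (suc D)
  □-C2 X Y a X-Y =
    subst (λ d → Dist BB (true , X) (false , Y) (suc (suc D) ∸ d))
          (sym (Box.δ-unique X-Y)) (□□-cross-dist X Y)

lemma9 : (n : ℕ) (Adj : Fin n → Fin n → Set) (D : ℕ) →
    Symmetric Adj → Irreflexive Adj → Connected Adj →
    IsDiam Adj D → C1 Adj D → C2 Adj D →
    IsDiam (BoxAdj Adj D) (suc D)
      × C1 (BoxAdj Adj D) (suc D)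
      × C2 (BoxAdj Adj D) (suc D)
lemma9 n Adj D Adj-sym _ _ diam c1 c2 = □-IsDiam , □-C1 , □-C2
  where open Doubling Adj-sym D diam c1 c2
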